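{- $\textsc{\#Disj2Sat}\in \mathsf{\Sigma QSO(\Sigma_2\text{ - }2SAT)}$; that is, there is a $\mathsf{\Sigma QSO(\Sigma_2\text{ - }2SAT)}$ sentence $\alpha$ over the vocabulary $\sigma=\{C_1,C_2,C_3,C_4,D\}$ such that for every ordered $\sigma$-structure $\mathcal{A}$ encoding a formula $\phi$ as described below, $[[\alpha]](\mathcal{A})$ equals the number of satisfying assignments of $\phi$.
   Context: $\textsc{\#Disj2Sat}$: given a propositional formula $\phi$ that is a disjunction of 2SAT formulae (each 2SAT formula being a conjunction of clauses with exactly two literals; a one-literal clause $l$ is written $l\vee l$), output the number of satisfying assignments of $\phi$. Such a $\phi$ is encoded as an ordered structure over $\sigma=\{C_1,C_2,C_3,C_4,D\}$ whose universe consists of the variables, clauses and disjuncts, where $C_1(c,x,y)$ iff clause $c$ is $x\vee y$, $C_2(c,x,y)$ iff $c$ is $\neg x\vee y$, $C_3(c,x,y)$ iff $c$ is $x\vee \neg y$, $C_4(c,x,y)$ iff $c$ is $\neg x\vee\neg y$, and $D(d,c)$ iff clause $c$ appears in disjunct $d$. $\mathsf{\Sigma QSO(\Sigma_2\text{ - }2SAT)}$: first-order formulae over a relational vocabulary $\sigma$ are built by $\phi ::= x=y \mid R(\vec x) \mid \neg\phi \mid \phi\vee\phi \mid \exists x\phi \mid \top \mid \bot$ with $R\in\sigma$. A literal is $X(\vec x)$ or $\neg X(\vec x)$ with $X$ a second-order variable. A 2SAT clause over $\sigma$ is $\phi_1\vee\phi_2\vee\phi_3$ where each $\phi_i$ is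 a literal or a first-order formula over $\sigma$, at least one $\phi_i$ being a first-order formula. A $\Sigma_2$-2SAT formula is $\exists\vec x\forall\vec y\bigwedge_{j=1}^k C_j(\vec x,\vec y)$ with each $C_j$ a 2SAT clause. $\mathsf{\Sigma QSO(\Sigma_2\text{ - }2SAT)}$ formulae: $\alpha ::= \phi \mid s \mid (\alpha+\alpha)\mid \Sigma x.\alpha \mid \Sigma X.\alpha$, with $\phi$ a $\Sigma_2$-2SAT formula, $s\in\mathbb{N}$. Semantics: $[[\phi]]=1$ if the structure (with the current assignments) satisfies $\phi$, else $0$; $[[s]]=s$; $+$ is addition; $[[\Sigma x.\alpha]](\mathcal{A},v,V)=\sum_{a\in A}[[\alpha]](\mathcal{A},v[a/x],V)$; $[[\Sigma X.\alpha]](\mathcal{A},v,V)=\sum_{B\subseteq A^{\mathrm{arity}(X)}}[[\alpha]](\mathcal{A},v,V[B/X])$. A sentence $\alpha$ defines the counting function $\mathcal{A}\mapsto[[\alpha]](\mathcal{A})$ on finite ordered structures. -}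

module Defs where

open import Data.Nat using (ℕ; zero; suc; _+_)
open import Data.Bool using (Bool; true; false; _∧_; _∨_; not; if_then_else_)
open import Data.Fin using (Fin; toℕ)
import Data.Fin as Fin
open import Data.Vec using (Vec; []; _∷_; _++_; lookup)
import Data.Vec as Vec
open import Data.List using (List; []; _∷_; map; allFin; concatMap)
open import Data.Bool.ListAction using (all; any)
open import Data.Nat.ListAction using (sum)
open import Data.List.Membership.Propositional using (_∈_)
open import Data.List.Relation.Unary.All using (All)
import Data.List.Relation.Unary.All as All
open import Data.Fin using (_<?_)
open import Data.Sum using (_⊎_; inj₁; inj₂)
open import Data.Product using (Σ; ∃; _×_; _,_)
open import Data.Unit using (⊤)
open import Data.Empty using (⊥)
open import Relation.Nullary.Decidable using (⌊_⌋)
open import Relation.Binary.PropositionalEquality using (_≡_)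
open import Function.Bundles using (_⤖_; Bijection)

vecsOf : {T : Set} → List T → (m : ℕ) → List (Vec T m)
vecsOf L zero    = [] ∷ []
vecsOf L (suc m) = concatMap (λ x → map (x ∷_) (vecsOf L m)) L

bools : List Bool
bools = false ∷ true ∷ []

_==ᶠ_ : {n : ℕ} → Fin n → Fin n → Bool
i ==ᶠ j = ⌊ i Fin.≟ j ⌋

_==ᵇ_ : Bool → Bool → Bool
true  ==ᵇ b = b
false ==ᵇ b = not b

boolToℕ : Bool → ℕ
boolToℕ b = if b then 1 else 0

-- Finite ordered σ-structures, σ = {C₁,C₂,C₃,C₄,D}.
-- Universe is Fin n, with its natural linear order.

record Structure : Set where
  field
    n  : ℕ
    C₁ C₂ C₃ C₄ : Fin n → Fin n → Fin n → Bool
    D  : Fin n → Fin n → Bool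
open Structure public

data Sym : Set where
  c₁ c₂ c₃ c₄ d : Sym

arity : Sym → ℕ
arity c₁ = 3
arity c₂ = 3
arity c₃ = 3
arity c₄ = 3
arity d  = 2

interp : (A : Structure) (R : Sym) → Vec (Fin (n A)) (arity R) → Bool
interp A c₁ (x ∷ y ∷ z ∷ []) = C₁ A x y z
interp A c₂ (x ∷ y ∷ z ∷ []) = C₂ A x y z
interp A c₃ (x ∷ y ∷ z ∷ []) = C₃ A x y z
interp A c₄ (x ∷ y ∷ z ∷ []) = C₄ A x y z
interp A d  (x ∷ y ∷ [])     = D A x y

-- First-order formulas over σ (de Bruijn: k free variables, index 0 newest).
-- `lt` is the built-in order of ordered structures.

data FO (k : ℕ) : Set where
  eq  : Fin k → Fin k → FO k
  lt  : Fin k → Fin k → FO k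
  rel : (R : Sym) → Vec (Fin k) (arity R) → FO k
  neg : FO k → FO k
  or  : FO k → FO k → FO k
  ex  : FO (suc k) → FO k
  top : FO k
  bot : FO k

evalFO : {k : ℕ} → FO k → (A : Structure) → Vec (Fin (n A)) k → Bool
evalFO (eq x y)   A ρ = lookup ρ x ==ᶠ lookup ρ y
evalFO (lt x y)   A ρ = ⌊ lookup ρ x <? lookup ρ y ⌋
evalFO (rel R xs) A ρ = interp A R (Vec.map (lookup ρ) xs)
evalFO (neg φ)    A ρ = not (evalFO φ A ρ)
evalFO (or φ ψ)   A ρ = evalFO φ A ρ ∨ evalFO ψ A ρ
evalFO (ex φ)     A ρ = any (λ a → evalFO φ A (a ∷ ρ)) (allFin (n A))
evalFO top        A ρ = true
evalFO bot        A ρ = false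

-- Second-order variables: context Δ of arities; a variable of arity a is a ∈ Δ.
-- An interpretation of an a-ary second-order variable over Fin n is a
-- table, i.e. a subset of (Fin n)^a given by its characteristic function.

Table : ℕ → ℕ → Set
Table n zero    = Bool
Table n (suc a) = Vec (Table n a) n

-- all subsets of (Fin n)^a, each exactly once
tables : (n a : ℕ) → List (Table n a)
tables n zero    = bools
tables n (suc a) = vecsOf (tables n a) n

member : {n a : ℕ} → Table n a → Vec (Fin n) a → Bool
member {a = zero}  b []       = b
member {a = suc a} t (i ∷ is) = member (lookup t i) is

SOEnv : ℕ → List ℕ → Set
SOEnv n Δ = All (Table n) Δ

data Atom (k : ℕ) (Δ : List ℕ) : Set where
  posLit : {a : ℕ} → a ∈ Δ → Vec (Fin k) a → Atom k Δ
  negLit : {a : ℕ} → a ∈ Δ → Vec (Fin k) a → Atom k Δ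
  fo     : FO k → Atom k Δ

IsFO : {k : ℕ} {Δ : List ℕ} → Atom k Δ → Set
IsFO (posLit _ _) = ⊥
IsFO (negLit _ _) = ⊥
IsFO (fo _)       = ⊤

record Clause (k : ℕ) (Δ : List ℕ) : Set where
  constructor clause
  field
    φ₁ φ₂ φ₃ : Atom k Δ
    hasFO    : IsFO φ₁ ⊎ IsFO φ₂ ⊎ IsFO φ₃

-- ∃ x̄ (length p) ∀ ȳ (length q) ⋀ⱼ Cⱼ(x̄,ȳ); clauses live in context q + (p + k)
record Σ₂2SAT (k : ℕ) (Δ : List ℕ) : Set where
  constructor σ₂
  field
    p q     : ℕ
    clauses : List (Clause (q + (p + k)) Δ)

evalAtom : {k : ℕ} {Δ : List ℕ} → Atom k Δ → (A : Structure) →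
           Vec (Fin (n A)) k → SOEnv (n A) Δ → Bool
evalAtom (posLit X xs) A ρ V = member (All.lookup V X) (Vec.map (lookup ρ) xs)
evalAtom (negLit X xs) A ρ V = not (member (All.lookup V X) (Vec.map (lookup ρ) xs))
evalAtom (fo φ)        A ρ V = evalFO φ A ρ

evalClause : {k : ℕ} {Δ : List ℕ} → Clause k Δ → (A : Structure) →
             Vec (Fin (n A)) k → SOEnv (n A) Δ → Bool
evalClause (clause φ₁ φ₂ φ₃ _) A ρ V =
  evalAtom φ₁ A ρ V ∨ evalAtom φ₂ A ρ V ∨ evalAtom φ₃ A ρ V

evalΣ₂ : {k : ℕ} {Δ : List ℕ} → Σ₂2SAT k Δ → (A : Structure) →
         Vec (Fin (n A)) k → SOEnv (n A) Δ → Bool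
evalΣ₂ (σ₂ p q cs) A ρ V =
  any (λ xs → all (λ ys → all (λ C → evalClause C A (ys ++ (xs ++ ρ)) V) cs)
                  (vecsOf (allFin (n A)) q))
      (vecsOf (allFin (n A)) p)

data QSO (k : ℕ) (Δ : List ℕ) : Set where
  formula : Σ₂2SAT k Δ → QSO k Δ
  const   : ℕ → QSO k Δ
  _⊕_     : QSO k Δ → QSO k Δ → QSO k Δ
  ΣFO     : QSO (suc k) Δ → QSO k Δ
  ΣSO     : (a : ℕ) → QSO k (a ∷ Δ) → QSO k Δ

⟦_⟧ : {k : ℕ} {Δ : List ℕ} → QSO k Δ → (A : Structure) →
      Vec (Fin (n A)) k → SOEnv (n A) Δ → ℕ
⟦ formula φ ⟧ A ρ V = boolToℕ (evalΣ₂ φ A ρ V)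
⟦ const s ⟧   A ρ V = s
⟦ α ⊕ β ⟧     A ρ V = ⟦ α ⟧ A ρ V + ⟦ β ⟧ A ρ V
⟦ ΣFO α ⟧     A ρ V = sum (map (λ a → ⟦ α ⟧ A (a ∷ ρ) V) (allFin (n A)))
⟦ ΣSO a α ⟧   A ρ V = sum (map (λ B → ⟦ α ⟧ A ρ (B All.∷ V)) (tables (n A) a))

Sentence : Set
Sentence = QSO 0 []

⟦_⟧ₛ : Sentence → Structure → ℕ
⟦ α ⟧ₛ A = ⟦ α ⟧ A [] All.[]

-- Clause c is  ℓ₁ ∨ ℓ₂  with ℓ₁ = (pol₁ c, var₁ c), ℓ₂ = (pol₂ c, var₂ c)
-- (polarity true = positive literal).  A one-literal clause l is l ∨ l.

record Disj2Sat : Set where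
  field
    nv nc nd   : ℕ
    var₁ var₂  : Fin nc → Fin nv
    pol₁ pol₂  : Fin nc → Bool
    inD        : Fin nd → Fin nc → Bool
    nonempty   : (δ : Fin nd) → ∃ λ c → inD δ c ≡ true
open Disj2Sat public

litVal : {nv : ℕ} → Bool → Fin nv → Vec Bool nv → Bool
litVal s x β = s ==ᵇ lookup β x

satisfies : (φ : Disj2Sat) → Vec Bool (nv φ) → Bool
satisfies φ β =
  any (λ δ → all (λ c → not (inD φ δ c) ∨
                         (litVal (pol₁ φ c) (var₁ φ c) β ∨ litVal (pol₂ φ c) (var₂ φ c) β))
                 (allFin (nc φ)))
      (allFin (nd φ))

-- number of satisfying assignments (assignments = Vec Bool nv, each listed once)
#sat : Disj2Sat → ℕ
#sat φ = sum (map (λ β → boolToℕ (satisfies φ β)) (vecsOf bools (nv φ)))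

Elem : Disj2Sat → Set
Elem φ = Fin (nv φ) ⊎ Fin (nc φ) ⊎ Fin (nd φ)

Crel : (φ : Disj2Sat) → Bool → Bool → Elem φ → Elem φ → Elem φ → Bool
Crel φ s t (inj₂ (inj₁ c)) (inj₁ x) (inj₁ y) =
  (pol₁ φ c ==ᵇ s) ∧ (pol₂ φ c ==ᵇ t) ∧ (var₁ φ c ==ᶠ x) ∧ (var₂ φ c ==ᶠ y)
Crel φ s t _ _ _ = false

Drel : (φ : Disj2Sat) → Elem φ → Elem φ → Bool
Drel φ (inj₂ (inj₂ δ)) (inj₂ (inj₁ c)) = inD φ δ c
Drel φ _ _ = false

Encodes : Structure → Disj2Sat → Set
Encodes A φ =
  Σ (Fin (n A) ⤖ Elem φ) λ e →
    let f = Bijection.to e in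
    (∀ a b c → C₁ A a b c ≡ Crel φ true  true  (f a) (f b) (f c)) ×
    (∀ a b c → C₂ A a b c ≡ Crel φ false true  (f a) (f b) (f c)) ×
    (∀ a b c → C₃ A a b c ≡ Crel φ true  false (f a) (f b) (f c)) ×
    (∀ a b c → C₄ A a b c ≡ Crel φ false false (f a) (f b) (f c)) ×
    (∀ a b   → D A a b     ≡ Drel φ (f a) (f b))

module Submission where

-- The sentence is  α = Σ X. ψ  with X unary and ψ the Σ₂-2SAT formula
--   ∃ a ∀ c x y.   Disj(a)
--                ∧ (¬X(c) ∨ Var(c))
--                ∧ ⋀_{s,u} (¬D(a,c) ∨ ¬C_{s,u}(c,x,y) ∨ X^s(x) ∨ X^u(y)),
-- where X^true = X, X^false = ¬X, and Disj, Var are the first-order definable kinds of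
-- elements (disjuncts are the elements with a D-successor, as disjuncts are nonempty;
-- clauses are first arguments of some C_{s,u}; variables are the rest).
-- Let A encode φ, t ⊆ A be a value of X, R t its restriction to the variables (an
-- assignment of φ) and E β the extension of an assignment β by false.  Then
--   ψ(t)  ⟺  t = E (R t)  and  R t satisfies φ        (ψ-characterisation):
-- the clause ¬X(c) ∨ Var(c) says that t lives on the variables, and for a disjunct a the
-- literal clauses say exactly that every clause of a is satisfied by R t.
-- Since R ∘ E = id, counting such t is counting satisfying assignments (sum-section).

open import Defs
open import Data.Bool using (Bool; true; false; T; _∧_; _∨_; not)
import Data.Bool as Bool
open import Data.Bool.ListAction using (all; any)
open import Data.Bool.Properties using (∨-identityʳ)
open import Data.Empty using (⊥-elim)
open import Data.Fin using (Fin; zero; suc)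
open import Data.List using (List; []; _∷_; map; _++_; concatMap; allFin)
open import Data.List.Membership.Propositional using (_∈_; lose)
open import Data.List.Membership.Propositional.Properties using (∈-map⁺; ∈-concat⁺′; ∈-allFin)
open import Data.List.Properties using (map-cong; map-++; map-∘)
open import Data.List.Relation.Unary.Any using (here; satisfied)
open import Data.List.Relation.Unary.Any.Properties using (any⁺; any⁻)
import Data.List.Relation.Unary.All as All
open import Data.List.Relation.Unary.All.Properties using (all⁺; all⁻)
open import Data.Nat using (ℕ; zero; suc; _+_; _*_)
open import Data.Nat.ListAction using (sum)
open import Data.Nat.ListAction.Properties using (sum-++)
open import Data.Nat.Properties using (+-identityʳ; *-identityˡ; +-commutativeSemigroup)
open import Algebra.Properties.CommutativeSemigroup +-commutativeSemigroup using (interchange)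
open import Data.Product using (Σ; ∃; _×_; _,_; proj₁; proj₂)
open import Data.Sum using (_⊎_; inj₁; inj₂)
open import Data.Unit using (tt)
open import Data.Vec using (Vec; []; _∷_; lookup; tabulate)
import Data.Vec as Vec
open import Data.Vec.Properties using (lookup∘tabulate; tabulate∘lookup; tabulate-cong)
import Data.Vec.Properties as Vecₚ
open import Function using (_∘_)
open import Function.Bundles using (Bijection)
open import Relation.Binary.PropositionalEquality
open import Relation.Nullary using (Dec; yes; no; does; ¬_)
open import Relation.Nullary.Decidable using (toWitness; fromWitness)

T-ext : ∀ {a b : Bool} → (T a → T b) → (T b → T a) → a ≡ b
T-ext {false} {false} _ _ = refl
T-ext {false} {true}  _ q = ⊥-elim (q tt)
T-ext {true}  {false} p _ = ⊥-elim (p tt)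
T-ext {true}  {true}  _ _ = refl

∧-intro : ∀ {a b} → T a → T b → T (a ∧ b)
∧-intro {true} _ q = q

∧-elim : ∀ {a b} → T (a ∧ b) → T a × T b
∧-elim {true} q = tt , q

∨-introˡ : ∀ a {b} → T a → T (a ∨ b)
∨-introˡ true _ = tt

∨-introʳ : ∀ a {b} → T b → T (a ∨ b)
∨-introʳ true  _ = tt
∨-introʳ false p = p

-- The clauses of ψ are implications: ¬b ∨ c is b ⇒ c, and (¬b ∨ ¬b') ∨ c is b ⇒ b' ⇒ c.
⇒-elim : ∀ b {c} → T (not b ∨ c) → T b → T c
⇒-elim true p _ = p

⇒-intro : ∀ b {c} → (T b → T c) → T (not b ∨ c)
⇒-intro false _ = tt
⇒-intro true  p = p tt

⇒₂-elim : ∀ b b' {c} → T ((not b ∨ not b') ∨ c) → T b → T b' → T c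
⇒₂-elim true true p _ _ = p

⇒₂-intro : ∀ b b' {c} → (T b → T b' → T c) → T ((not b ∨ not b') ∨ c)
⇒₂-intro false _     _ = tt
⇒₂-intro true  false _ = tt
⇒₂-intro true  true  p = p tt tt

==ᵇ-sound : ∀ a b → T (a ==ᵇ b) → a ≡ b
==ᵇ-sound true  true  _ = refl
==ᵇ-sound false false _ = refl

==ᵇ-refl : ∀ a → T (a ==ᵇ a)
==ᵇ-refl true  = tt
==ᵇ-refl false = tt

==ᶠ-sound : ∀ {m} (i j : Fin m) → T (i ==ᶠ j) → i ≡ j
==ᶠ-sound i j = toWitness

==ᶠ-refl : ∀ {m} (i : Fin m) → T (i ==ᶠ i)
==ᶠ-refl i = fromWitness refl

does-sound : ∀ {P : Set} (d : Dec P) → T (does d) → P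
does-sound (yes p) _ = p

does-complete : ∀ {P : Set} (d : Dec P) → P → T (does d)
does-complete (yes _) _ = tt
does-complete (no ¬p) p = ¬p p

boolToℕ-∧ : ∀ a b → boolToℕ (a ∧ b) ≡ boolToℕ a * boolToℕ b
boolToℕ-∧ true  b = sym (*-identityˡ _)
boolToℕ-∧ false b = refl

module _ {X : Set} (h : X → Bool) where

  any-witness : ∀ L → T (any h L) → ∃ λ x → T (h x)
  any-witness L = satisfied ∘ any⁻ h L

  any-intro : ∀ {L x} → x ∈ L → T (h x) → T (any h L)
  any-intro x∈L hx = any⁺ h (lose x∈L hx)

  all-elim : ∀ {L} → T (all h L) → ∀ {x} → x ∈ L → T (h x)
  all-elim {L} p = All.lookup (all⁺ h L p)

  all-intro : ∀ L → (∀ x → T (h x)) → T (all h L)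
  all-intro L q = all⁻ h (All.universal q L)

∈-vecsOf : ∀ {X : Set} {L : List X} → (∀ x → x ∈ L) → ∀ {m} (v : Vec X m) → v ∈ vecsOf L m
∈-vecsOf complete []      = here refl
∈-vecsOf complete (x ∷ v) =
  ∈-concat⁺′ (∈-map⁺ (x ∷_) (∈-vecsOf complete v)) (∈-map⁺ _ (complete x))

module _ {X : Set} where

  sum-cong : ∀ {h h' : X → ℕ} L → (∀ x → h x ≡ h' x) → sum (map h L) ≡ sum (map h' L)
  sum-cong L q = cong sum (map-cong q L)

  sum-zero : ∀ {h : X → ℕ} L → (∀ x → h x ≡ 0) → sum (map h L) ≡ 0
  sum-zero []      q = refl
  sum-zero (x ∷ L) q = cong₂ _+_ (q x) (sum-zero L q)

  sum-+ : ∀ (h k : X → ℕ) L → sum (map (λ x → h x + k x) L) ≡ sum (map h L) + sum (map k L)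
  sum-+ h k []      = refl
  sum-+ h k (x ∷ L) = trans (cong (h x + k x +_) (sum-+ h k L)) (interchange (h x) (k x) _ _)

  sum-++ᵐ : ∀ (h : X → ℕ) L L' → sum (map h (L ++ L')) ≡ sum (map h L) + sum (map h L')
  sum-++ᵐ h L L' = trans (cong sum (map-++ h L L')) (sum-++ (map h L) (map h L'))

sum-swap : ∀ {X Y : Set} (H : X → Y → ℕ) (L : List X) (M : List Y) →
           sum (map (λ x → sum (map (H x) M)) L) ≡ sum (map (λ y → sum (map (λ x → H x y) L)) M)
sum-swap H []      M = sym (sum-zero M (λ _ → refl))
sum-swap H (x ∷ L) M =
  trans (cong (sum (map (H x) M) +_) (sum-swap H L M)) (sym (sum-+ (H x) _ M))

sum-concatMap : ∀ {X Y : Set} (h : Y → ℕ) (F : X → List Y) L →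
                sum (map h (concatMap F L)) ≡ sum (map (λ x → sum (map h (F x))) L)
sum-concatMap h F []      = refl
sum-concatMap h F (x ∷ L) =
  trans (sum-++ᵐ h (F x) (concatMap F L)) (cong (sum (map h (F x)) +_) (sum-concatMap h F L))

sum-vecsOf-suc : ∀ {X : Set} (L : List X) m (h : Vec X (suc m) → ℕ) →
                 sum (map h (vecsOf L (suc m))) ≡
                 sum (map (λ x → sum (map (λ v → h (x ∷ v)) (vecsOf L m))) L)
sum-vecsOf-suc L m h =
  trans (sum-concatMap h (λ x → map (x ∷_) (vecsOf L m)) L)
        (sum-cong L (λ x → cong sum (sym (map-∘ (vecsOf L m)))))

_≟ᵛ_ : ∀ {m} (v w : Vec Bool m) → Dec (v ≡ w)
_≟ᵛ_ = Vecₚ.≡-dec Bool._≟_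

δ : ∀ {m} → Vec Bool m → Vec Bool m → ℕ
δ v w = boolToℕ (does (v ≟ᵛ w))

δ-distinct : ∀ {m} {v w : Vec Bool m} → ¬ v ≡ w → δ v w ≡ 0
δ-distinct {v = v} {w} v≢w with v ≟ᵛ w
... | yes v≡w = ⊥-elim (v≢w v≡w)
... | no _    = refl

sum-δ : ∀ m (w : Vec Bool m) (G : Vec Bool m → ℕ) →
        sum (map (λ v → δ v w * G v) (vecsOf bools m)) ≡ G w
sum-δ zero    []          G = trans (+-identityʳ _) (+-identityʳ (G []))
sum-δ (suc m) (false ∷ w) G =
  trans (sum-vecsOf-suc bools m _)
        (trans (cong₂ (λ p q → p + (q + 0)) (sum-δ m w (G ∘ (false ∷_)))
                                             (sum-zero (vecsOf bools m) (λ _ → refl)))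
               (+-identityʳ _))
sum-δ (suc m) (true ∷ w)  G =
  trans (sum-vecsOf-suc bools m _)
        (trans (cong₂ (λ p q → p + (q + 0)) (sum-zero (vecsOf bools m) (λ _ → refl))
                                             (sum-δ m w (G ∘ (true ∷_))))
               (+-identityʳ _))

sum-section : ∀ {k m} (E : Vec Bool k → Vec Bool m) (R : Vec Bool m → Vec Bool k) →
              (∀ β → R (E β) ≡ β) → (G : Vec Bool k → ℕ) →
              sum (map (λ t → δ t (E (R t)) * G (R t)) (vecsOf bools m)) ≡ sum (map G (vecsOf bools k))
sum-section {k} {m} E R R∘E G = begin
  sum (map (λ t → δ t (E (R t)) * G (R t)) Ts)
    ≡⟨ sum-cong Ts (λ t → sym (sum-δ k (R t) (λ β → δ t (E (R t)) * G β))) ⟩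
  sum (map (λ t → sum (map (λ β → δ β (R t) * (δ t (E (R t)) * G β)) Bs)) Ts)
    ≡⟨ sum-cong Ts (λ t → sum-cong Bs (λ β → δ-fibre t β (G β))) ⟩
  sum (map (λ t → sum (map (λ β → δ t (E β) * G β) Bs)) Ts)
    ≡⟨ sum-swap (λ t β → δ t (E β) * G β) Ts Bs ⟩
  sum (map (λ β → sum (map (λ t → δ t (E β) * G β) Ts)) Bs)
    ≡⟨ sum-cong Bs (λ β → sum-δ m (E β) (λ _ → G β)) ⟩
  sum (map G Bs) ∎
  where
  open ≡-Reasoning

  Ts : List (Vec Bool m)
  Ts = vecsOf bools m

  Bs : List (Vec Bool k)
  Bs = vecsOf bools k

  -- t = E β  iff  β = R t and t = E (R t)
  δ-fibre : ∀ t β x → δ β (R t) * (δ t (E (R t)) * x) ≡ δ t (E β) * x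
  δ-fibre t β x with β ≟ᵛ R t
  ... | yes refl = *-identityˡ _
  ... | no β≢Rt  = sym (cong (_* x) (δ-distinct λ t≡Eβ → β≢Rt (trans (sym (R∘E β)) (cong R (sym t≡Eβ)))))

X : 1 ∈ (1 ∷ [])
X = here refl

-- First-order variables of the matrix: the ∀-block c x y followed by the ∃-variable a.
vc vx vy va : Fin 4
vc = zero
vx = suc zero
vy = suc (suc zero)
va = suc (suc (suc zero))

relC : ∀ {k} → Bool → Bool → Vec (Fin k) 3 → FO k
relC true  true  = rel c₁
relC false true  = rel c₂
relC true  false = rel c₃
relC false false = rel c₄

isDisjAt : ∀ {k} → Fin k → FO k
isDisjAt i = ex (rel d (suc i ∷ zero ∷ []))

someRelC : ∀ {k} → Fin k → Fin k → Fin k → FO k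
someRelC i j l = or (or (relC true true v) (relC false true v)) (or (relC true false v) (relC false false v))
  where
  v : Vec (Fin _) 3
  v = i ∷ j ∷ l ∷ []

isClauseAt : ∀ {k} → Fin k → FO k
isClauseAt i = ex (ex (someRelC (suc (suc i)) (suc zero) zero))

isVarAt : ∀ {k} → Fin k → FO k
isVarAt i = neg (or (isClauseAt i) (isDisjAt i))

lit : Bool → Fin 4 → Atom 4 (1 ∷ [])
lit true  i = posLit X (i ∷ [])
lit false i = negLit X (i ∷ [])

disjClause varClause : Clause 4 (1 ∷ [])
disjClause = clause (fo (isDisjAt va)) (fo bot) (fo bot) (inj₁ tt)
varClause  = clause (negLit X (vc ∷ [])) (fo (isVarAt vc)) (fo bot) (inj₂ (inj₁ tt))

litClause : Bool → Bool → Clause 4 (1 ∷ [])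
litClause s u =
  clause (fo (or (neg (rel d (va ∷ vc ∷ []))) (neg (relC s u (vc ∷ vx ∷ vy ∷ [])))))
         (lit s vx) (lit u vy) (inj₁ tt)

matrix : List (Clause 4 (1 ∷ []))
matrix = disjClause ∷ varClause ∷
         litClause true true ∷ litClause false true ∷ litClause true false ∷ litClause false false ∷ []

ψ : Σ₂2SAT 0 (1 ∷ [])
ψ = σ₂ 1 3 matrix

α : Sentence
α = ΣSO 1 (formula ψ)

isVar isClause isDisj : ∀ {V C D : Set} → V ⊎ C ⊎ D → Bool
isVar (inj₁ _) = true
isVar (inj₂ _) = false
isClause (inj₂ (inj₁ _)) = true
isClause _               = false
isDisj (inj₂ (inj₂ _)) = true
isDisj _               = false

kinds : ∀ {V C D : Set} (e : V ⊎ C ⊎ D) → not (isClause e ∨ isDisj e) ≡ isVar e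
kinds (inj₁ _)        = refl
kinds (inj₂ (inj₁ _)) = refl
kinds (inj₂ (inj₂ _)) = refl

isClause-inv : ∀ {V C D : Set} (e : V ⊎ C ⊎ D) → T (isClause e) → ∃ λ c → e ≡ inj₂ (inj₁ c)
isClause-inv (inj₂ (inj₁ c)) _ = c , refl

isDisj-inv : ∀ {V C D : Set} (e : V ⊎ C ⊎ D) → T (isDisj e) → ∃ λ δ → e ≡ inj₂ (inj₂ δ)
isDisj-inv (inj₂ (inj₂ δ)) _ = δ , refl

module Intended (φ : Disj2Sat) where

  clauseHolds : Fin (nc φ) → Vec Bool (nv φ) → Bool
  clauseHolds c β = litVal (pol₁ φ c) (var₁ φ c) β ∨ litVal (pol₂ φ c) (var₂ φ c) β

  disjunctHolds : Fin (nd φ) → Vec Bool (nv φ) → Bool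
  disjunctHolds δ β = all (λ c → not (inD φ δ c) ∨ clauseHolds c β) (allFin (nc φ))

  anyCrel : Elem φ → Elem φ → Elem φ → Bool
  anyCrel e x y = (Crel φ true true e x y ∨ Crel φ false true e x y) ∨
                  (Crel φ true false e x y ∨ Crel φ false false e x y)

  Crel-own : ∀ c {e x y} → e ≡ inj₂ (inj₁ c) → x ≡ inj₁ (var₁ φ c) → y ≡ inj₁ (var₂ φ c) →
             T (Crel φ (pol₁ φ c) (pol₂ φ c) e x y)
  Crel-own c refl refl refl =
    ∧-intro (==ᵇ-refl (pol₁ φ c))
      (∧-intro (==ᵇ-refl (pol₂ φ c)) (∧-intro (==ᶠ-refl (var₁ φ c)) (==ᶠ-refl (var₂ φ c))))

  Crel-inv : ∀ {s u} e x y → T (Crel φ s u e x y) →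
             ∃ λ c → e ≡ inj₂ (inj₁ c) × x ≡ inj₁ (var₁ φ c) × y ≡ inj₁ (var₂ φ c) ×
                     pol₁ φ c ≡ s × pol₂ φ c ≡ u
  Crel-inv (inj₂ (inj₁ c)) (inj₁ x) (inj₁ y) p
    with ∧-elim p
  ... | ps , q with ∧-elim q
  ... | pu , r with ∧-elim r
  ... | px , py =
    c , refl , cong inj₁ (sym (==ᶠ-sound _ _ px)) , cong inj₁ (sym (==ᶠ-sound _ _ py)) ,
    ==ᵇ-sound _ _ ps , ==ᵇ-sound _ _ pu

  anyCrel-intro : ∀ s u {e x y} → T (Crel φ s u e x y) → T (anyCrel e x y)
  anyCrel-intro s u {e} {x} {y} = intro s u
    where
    C : Bool → Bool → Bool
    C s u = Crel φ s u e x y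

    intro : ∀ s u → T (C s u) → T (anyCrel e x y)
    intro true  true  p = ∨-introˡ (C true true ∨ C false true) (∨-introˡ (C true true) p)
    intro false true  p = ∨-introˡ (C true true ∨ C false true) (∨-introʳ (C true true) p)
    intro true  false p = ∨-introʳ (C true true ∨ C false true) (∨-introˡ (C true false) p)
    intro false false p = ∨-introʳ (C true true ∨ C false true) (∨-introʳ (C true false) p)

  anyCrel-source : ∀ e x y → T (anyCrel e x y) → T (isClause e)
  anyCrel-source (inj₂ (inj₁ _)) _ _ _ = tt

  Drel-source : ∀ e e′ → T (Drel φ e e′) → T (isDisj e)
  Drel-source (inj₂ (inj₂ _)) _ _ = tt

module Encoding (A : Structure) (φ : Disj2Sat) (enc : Encodes A φ) where

  open Intended φ

  U : Set
  U = Fin (n A)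

  f : U → Elem φ
  f = Bijection.to (proj₁ enc)

  g : Elem φ → U
  g e = proj₁ (Bijection.surjective (proj₁ enc) e)

  f∘g : ∀ e → f (g e) ≡ e
  f∘g e = proj₂ (Bijection.surjective (proj₁ enc) e) refl

  g∘f : ∀ a → g (f a) ≡ a
  g∘f a = Bijection.injective (proj₁ enc) (f∘g (f a))

  D-enc : ∀ a b → D A a b ≡ Drel φ (f a) (f b)
  D-enc = proj₂ (proj₂ (proj₂ (proj₂ (proj₂ enc))))

  relC-enc : ∀ {k} s u (i j l : Fin k) ρ →
             evalFO (relC s u (i ∷ j ∷ l ∷ [])) A ρ ≡
             Crel φ s u (f (lookup ρ i)) (f (lookup ρ j)) (f (lookup ρ l))
  relC-enc true  true  i j l ρ = proj₁ (proj₂ enc) _ _ _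
  relC-enc false true  i j l ρ = proj₁ (proj₂ (proj₂ enc)) _ _ _
  relC-enc true  false i j l ρ = proj₁ (proj₂ (proj₂ (proj₂ enc))) _ _ _
  relC-enc false false i j l ρ = proj₁ (proj₂ (proj₂ (proj₂ (proj₂ enc)))) _ _ _

  someRelC-enc : ∀ {k} (i j l : Fin k) ρ →
                 evalFO (someRelC i j l) A ρ ≡ anyCrel (f (lookup ρ i)) (f (lookup ρ j)) (f (lookup ρ l))
  someRelC-enc i j l ρ =
    cong₂ _∨_ (cong₂ _∨_ (relC-enc true true i j l ρ) (relC-enc false true i j l ρ))
              (cong₂ _∨_ (relC-enc true false i j l ρ) (relC-enc false false i j l ρ))

  -- Disj defines the disjuncts; this uses that disjuncts are nonempty.
  disj-eval : ∀ {k} (i : Fin k) ρ → evalFO (isDisjAt i) A ρ ≡ isDisj (f (lookup ρ i))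
  disj-eval i ρ = T-ext sound complete
    where
    a : U
    a = lookup ρ i

    sound : T (any (D A a) (allFin (n A))) → T (isDisj (f a))
    sound p with any-witness (D A a) (allFin (n A)) p
    ... | z , Daz = Drel-source (f a) (f z) (subst T (D-enc a z) Daz)

    complete : T (isDisj (f a)) → T (any (D A a) (allFin (n A)))
    complete p with isDisj-inv (f a) p
    ... | δ , fa with nonempty φ δ
    ... | c , c∈δ = any-intro (D A a) (∈-allFin (g (inj₂ (inj₁ c))))
      (subst T (sym (trans (D-enc a _) (cong₂ (Drel φ) fa (f∘g _)))) (subst T (sym c∈δ) tt))

  -- Cl defines the clauses: each clause is C-related to its own variables.
  clause-eval : ∀ {k} (i : Fin k) ρ → evalFO (isClauseAt i) A ρ ≡ isClause (f (lookup ρ i))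
  clause-eval i ρ = T-ext sound complete
    where
    a : U
    a = lookup ρ i

    someC : U → U → Bool
    someC x y = evalFO (someRelC (suc (suc i)) (suc zero) zero) A (y ∷ x ∷ ρ)

    someC-enc : ∀ x y → someC x y ≡ anyCrel (f a) (f x) (f y)
    someC-enc x y = someRelC-enc (suc (suc i)) (suc zero) zero (y ∷ x ∷ ρ)

    sound : T (any (λ x → any (someC x) (allFin (n A))) (allFin (n A))) → T (isClause (f a))
    sound p with any-witness _ (allFin (n A)) p
    ... | x , q with any-witness (someC x) (allFin (n A)) q
    ... | y , r = anyCrel-source (f a) (f x) (f y) (subst T (someC-enc x y) r)

    complete : T (isClause (f a)) → T (any (λ x → any (someC x) (allFin (n A))) (allFin (n A)))
    complete p with isClause-inv (f a) p
    ... | c , fa = any-intro _ (∈-allFin x) (any-intro (someC x) (∈-allFin y)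
        (subst T (sym (someC-enc x y))
           (anyCrel-intro (pol₁ φ c) (pol₂ φ c) {f a} {f x} {f y} (Crel-own c fa (f∘g _) (f∘g _)))))
      where
      x y : U
      x = g (inj₁ (var₁ φ c))
      y = g (inj₁ (var₂ φ c))

  var-eval : ∀ {k} (i : Fin k) ρ → evalFO (isVarAt i) A ρ ≡ isVar (f (lookup ρ i))
  var-eval i ρ = trans (cong not (cong₂ _∨_ (clause-eval i ρ) (disj-eval i ρ))) (kinds (f (lookup ρ i)))

  Env : Vec Bool (n A) → SOEnv (n A) (1 ∷ [])
  Env t = t All.∷ All.[]

  lit-eval : ∀ s t (ρ : Vec U 4) i → evalAtom (lit s i) A ρ (Env t) ≡ (s ==ᵇ lookup t (lookup ρ i))
  lit-eval true  _ _ _ = refl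
  lit-eval false _ _ _ = refl

  LitClause : Vec Bool (n A) → (a c x y : U) → Bool → Bool → Bool
  LitClause t a c x y s u =
    (not (D A a c) ∨ not (Crel φ s u (f c) (f x) (f y))) ∨ ((s ==ᵇ lookup t x) ∨ (u ==ᵇ lookup t y))

  Matrix : Vec Bool (n A) → (a c x y : U) → Set
  Matrix t a c x y =
    T (isDisj (f a)) × T (not (lookup t c) ∨ isVar (f c)) × (∀ s u → T (LitClause t a c x y s u))

  module _ (t : Vec Bool (n A)) (a c x y : U) where

    private
      ρ : Vec U 4
      ρ = c ∷ x ∷ y ∷ a ∷ []

      clauseAt : Clause 4 (1 ∷ []) → Bool
      clauseAt C = evalClause C A ρ (Env t)

    disjClause-eval : clauseAt disjClause ≡ isDisj (f a)
    disjClause-eval = trans (∨-identityʳ _) (disj-eval va ρ)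

    varClause-eval : clauseAt varClause ≡ not (lookup t c) ∨ isVar (f c)
    varClause-eval = cong (not (lookup t c) ∨_) (trans (∨-identityʳ _) (var-eval vc ρ))

    litClause-eval : ∀ s u → clauseAt (litClause s u) ≡ LitClause t a c x y s u
    litClause-eval s u =
      cong₂ _∨_ (cong (λ b → not (D A a c) ∨ not b) (relC-enc s u vc vx vy ρ))
                (cong₂ _∨_ (lit-eval s t ρ vx) (lit-eval u t ρ vy))

    matrix-sound : T (all clauseAt matrix) → Matrix t a c x y
    matrix-sound p with all⁺ clauseAt matrix p
    ... | p₀ All.∷ p₁ All.∷ ptt All.∷ pft All.∷ ptf All.∷ pff All.∷ All.[] =
      subst T disjClause-eval p₀ , subst T varClause-eval p₁ , lits
      where
      lits : ∀ s u → T (LitClause t a c x y s u)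
      lits true  true  = subst T (litClause-eval true true) ptt
      lits false true  = subst T (litClause-eval false true) pft
      lits true  false = subst T (litClause-eval true false) ptf
      lits false false = subst T (litClause-eval false false) pff

    matrix-complete : Matrix t a c x y → T (all clauseAt matrix)
    matrix-complete (p₀ , p₁ , lits) = all⁻ clauseAt {xs = matrix}
      ( subst T (sym disjClause-eval) p₀
      All.∷ subst T (sym varClause-eval) p₁
      All.∷ litHolds true true All.∷ litHolds false true
      All.∷ litHolds true false All.∷ litHolds false false All.∷ All.[])
      where
      litHolds : ∀ s u → T (clauseAt (litClause s u))
      litHolds s u = subst T (sym (litClause-eval s u)) (lits s u)

  extend : Vec Bool (nv φ) → Elem φ → Bool
  extend β (inj₁ v) = lookup β v
  extend β (inj₂ _) = false

  extend-var : ∀ β e → T (extend β e) → T (isVar e)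
  extend-var β (inj₁ _) _ = tt

  R : Vec Bool (n A) → Vec Bool (nv φ)
  R t = tabulate (λ v → lookup t (g (inj₁ v)))

  E : Vec Bool (nv φ) → Vec Bool (n A)
  E β = tabulate (λ a → extend β (f a))

  R∘E : ∀ β → R (E β) ≡ β
  R∘E β = trans (tabulate-cong λ v → trans (lookup∘tabulate _ (g (inj₁ v))) (cong (extend β) (f∘g (inj₁ v))))
                (tabulate∘lookup β)

  R-at : ∀ t v → lookup (R t) v ≡ lookup t (g (inj₁ v))
  R-at t v = lookup∘tabulate _ v

  R-lookup : ∀ t {a v} → f a ≡ inj₁ v → lookup (R t) v ≡ lookup t a
  R-lookup t {a} fa = trans (R-at t _) (cong (lookup t) (trans (cong g (sym fa)) (g∘f a)))

  VarsOnly : Vec Bool (n A) → Set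
  VarsOnly t = ∀ c → T (not (lookup t c) ∨ isVar (f c))

  varsOnly⇒section : ∀ t → VarsOnly t → t ≡ E (R t)
  varsOnly⇒section t only = trans (sym (tabulate∘lookup t)) (tabulate-cong λ a → pointwise a (only a))
    where
    pointwise : ∀ a → T (not (lookup t a) ∨ isVar (f a)) → lookup t a ≡ extend (R t) (f a)
    pointwise a h with f a in fa
    ... | inj₁ v = sym (R-lookup t fa)
    ... | inj₂ _ = T-ext (⇒-elim (lookup t a) h) λ ()

  section⇒varsOnly : ∀ t → t ≡ E (R t) → VarsOnly t
  section⇒varsOnly t t≡ c = ⇒-intro (lookup t c) λ tc →
    extend-var (R t) (f c) (subst T (trans (cong (λ w → lookup w c) t≡) (lookup∘tabulate _ c)) tc)

  LitClauses : Vec Bool (n A) → U → Set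
  LitClauses t a = ∀ c x y s u → T (LitClause t a c x y s u)

  module _ (t : Vec Bool (n A)) {a : U} {δ : Fin (nd φ)} (fa : f a ≡ inj₂ (inj₂ δ)) where

    litClauses⇒ : LitClauses t a → T (disjunctHolds δ (R t))
    litClauses⇒ h = all-intro _ (allFin (nc φ)) λ c → ⇒-intro (inD φ δ c) (holds c)
      where
      -- instantiate the literal clause at c and its own variables
      holds : ∀ c → T (inD φ δ c) → T (clauseHolds c (R t))
      holds c c∈δ =
        subst T (cong₂ (λ b b' → (pol₁ φ c ==ᵇ b) ∨ (pol₂ φ c ==ᵇ b')) (sym (R-at t _)) (sym (R-at t _)))
          (⇒₂-elim (D A a cl) _ (h cl x y (pol₁ φ c) (pol₂ φ c)) D-a-cl (Crel-own c (f∘g _) (f∘g _) (f∘g _)))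
        where
        cl x y : U
        cl = g (inj₂ (inj₁ c))
        x  = g (inj₁ (var₁ φ c))
        y  = g (inj₁ (var₂ φ c))

        D-a-cl : T (D A a cl)
        D-a-cl = subst T (sym (trans (D-enc a cl) (cong₂ (Drel φ) fa (f∘g _)))) c∈δ

    litClauses⇐ : T (disjunctHolds δ (R t)) → LitClauses t a
    litClauses⇐ sat c x y s u =
      ⇒₂-intro (D A a c) (Crel φ s u (f c) (f x) (f y)) λ D-a-c C-cxy →
        holds D-a-c (Crel-inv (f c) (f x) (f y) C-cxy)
      where
      -- C_{s,u}(c,x,y) forces c to be a clause of δ with literals x^s, y^u
      holds : ∀ {s u} → T (D A a c) →
              (∃ λ c' → f c ≡ inj₂ (inj₁ c') × f x ≡ inj₁ (var₁ φ c') × f y ≡ inj₁ (var₂ φ c') ×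
                        pol₁ φ c' ≡ s × pol₂ φ c' ≡ u) →
              T ((s ==ᵇ lookup t x) ∨ (u ==ᵇ lookup t y))
      holds D-a-c (c' , fc , fx , fy , refl , refl) =
        subst T (cong₂ (λ b b' → (pol₁ φ c' ==ᵇ b) ∨ (pol₂ φ c' ==ᵇ b')) (R-lookup t fx) (R-lookup t fy))
          (⇒-elim (inD φ δ c') (all-elim _ sat (∈-allFin c'))
            (subst₂ (λ e e' → T (Drel φ e e')) fa fc (subst T (D-enc a c) D-a-c)))

  matrices⇒ : ∀ t a → (∀ c x y → Matrix t a c x y) → t ≡ E (R t) × T (satisfies φ (R t))
  matrices⇒ t a M with isDisj-inv (f a) (proj₁ (M a a a))
  ... | δ , fa =
    varsOnly⇒section t (λ c → proj₁ (proj₂ (M c c c))) ,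
    any-intro _ (∈-allFin δ) (litClauses⇒ t fa λ c x y → proj₂ (proj₂ (M c x y)))

  matrices⇐ : ∀ t δ → t ≡ E (R t) → T (disjunctHolds δ (R t)) →
              ∀ c x y → Matrix t (g (inj₂ (inj₂ δ))) c x y
  matrices⇐ t δ t≡ sat c x y =
    subst T (sym (cong isDisj fa)) tt , section⇒varsOnly t t≡ c , litClauses⇐ t fa sat c x y
    where
    fa : f (g (inj₂ (inj₂ δ))) ≡ inj₂ (inj₂ δ)
    fa = f∘g (inj₂ (inj₂ δ))

  ψ-body : Vec Bool (n A) → Vec U 1 → Vec U 3 → Bool
  ψ-body t as cxy = all (λ C → evalClause C A (cxy Vec.++ (as Vec.++ [])) (Env t)) matrix

  ψ⇒ : ∀ t → T (evalΣ₂ ψ A [] (Env t)) → t ≡ E (R t) × T (satisfies φ (R t))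
  ψ⇒ t p with any-witness (λ as → all (ψ-body t as) (vecsOf (allFin (n A)) 3)) (vecsOf (allFin (n A)) 1) p
  ... | a ∷ [] , q = matrices⇒ t a λ c x y →
    matrix-sound t a c x y (all-elim (ψ-body t (a ∷ [])) q (∈-vecsOf ∈-allFin (c ∷ x ∷ y ∷ [])))

  ψ⇐ : ∀ t → t ≡ E (R t) → T (satisfies φ (R t)) → T (evalΣ₂ ψ A [] (Env t))
  ψ⇐ t t≡ sat with any-witness _ (allFin (nd φ)) sat
  ... | δ , sat-δ =
    any-intro (λ as → all (ψ-body t as) (vecsOf (allFin (n A)) 3)) (∈-vecsOf ∈-allFin (a ∷ []))
      (all-intro (ψ-body t (a ∷ [])) (vecsOf (allFin (n A)) 3) λ where
        (c ∷ x ∷ y ∷ []) → matrix-complete t a c x y (matrices⇐ t δ t≡ sat-δ c x y))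
    where
    a : U
    a = g (inj₂ (inj₂ δ))

  ψ-characterisation : ∀ t → evalΣ₂ ψ A [] (Env t) ≡ does (t ≟ᵛ E (R t)) ∧ satisfies φ (R t)
  ψ-characterisation t = T-ext
    (λ p → let t≡ , sat = ψ⇒ t p in ∧-intro (does-complete (t ≟ᵛ E (R t)) t≡) sat)
    (λ p → let t≡ , sat = ∧-elim p in ψ⇐ t (does-sound (t ≟ᵛ E (R t)) t≡) sat)

theorem1 : Σ Sentence λ α →
    (A : Structure) (φ : Disj2Sat) → Encodes A φ → ⟦ α ⟧ₛ A ≡ #sat φ
theorem1 = α , counts
  where
  counts : (A : Structure) (φ : Disj2Sat) → Encodes A φ → ⟦ α ⟧ₛ A ≡ #sat φ
  counts A φ enc = begin
    sum (map (λ t → boolToℕ (evalΣ₂ ψ A [] (Env t))) Tables)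
      ≡⟨ sum-cong Tables (λ t → cong boolToℕ (ψ-characterisation t)) ⟩
    sum (map (λ t → boolToℕ (does (t ≟ᵛ E (R t)) ∧ satisfies φ (R t))) Tables)
      ≡⟨ sum-cong Tables (λ t → boolToℕ-∧ (does (t ≟ᵛ E (R t))) _) ⟩
    sum (map (λ t → δ t (E (R t)) * boolToℕ (satisfies φ (R t))) Tables)
      ≡⟨ sum-section E R R∘E (λ β → boolToℕ (satisfies φ β)) ⟩
    #sat φ ∎
    where
    open Encoding A φ enc
    open ≡-Reasoning

    Tables : List (Vec Bool (n A))
    Tables = vecsOf bools (n A)
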